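{- Let $n,j\in\mathbb{N}$ with $n\geq 3$ and $1\leq j$, $2j<\frac{n}{2}$. Then $0$ is an eigenvalue of the $I$-graph $I(n,j,2j)$ if and only if there exist an integer $l$ with $0\leq l\leq n-1$ and an integer $r\geq 0$ such that $3jl=n(1+3r)$, or $3jl=n(2+3r)$, or $10jl=n(1+10r)$, or $10jl=n(3+10r)$, or $10jl=n(7+10r)$, or $10jl=n(9+10r)$.
   Context: The $I$-graph $I(n,j,k)$ ($n\geq3$, $1\leq j\leq k<\frac n2$) has vertex set $\{a_i,b_i: 0\leq i\leq n-1\}$ and edge set $\{\{a_i,a_{i+j}\},\{a_i,b_i\},\{b_i,b_{i+k}\}: 0\leq i\leq n-1\}$, with indices taken modulo $n$. Eigenvalues are those of the adjacency matrix. -}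

module Defs where

open import Data.Nat using (ℕ; zero; suc; _+_; NonZero)
open import Data.Nat.DivMod using (_%_)
open import Data.Nat using (_≡ᵇ_)
open import Data.Bool using (Bool; true; false; _∨_; if_then_else_)
open import Data.Fin using (Fin; toℕ)
import Data.Fin as F
open import Data.Sum using (_⊎_; inj₁; inj₂)
open import Data.Product using (Σ; _×_; ∃)
open import Data.Rational using (ℚ; 0ℚ; 1ℚ) renaming (_+_ to _+q_; _*_ to _*q_)
open import Relation.Binary.PropositionalEquality using (_≡_)
open import Relation.Nullary using (¬_)

ΣFin : (n : ℕ) → (Fin n → ℚ) → ℚ
ΣFin zero    f = 0ℚ
ΣFin (suc n) f = f F.zero +q ΣFin n (λ i → f (F.suc i))

-- Vertex set of I(n,j,k): inj₁ i = a_i, inj₂ i = b_i.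
Vertex : ℕ → Set
Vertex n = Fin n ⊎ Fin n

ΣV : (n : ℕ) → (Vertex n → ℚ) → ℚ
ΣV n f = ΣFin n (λ i → f (inj₁ i)) +q ΣFin n (λ i → f (inj₂ i))

-- Adjacency in I(n,j,k): a_i ~ a_{i+j}, a_i ~ b_i, b_i ~ b_{i+k} (indices mod n).
adjI : (n j k : ℕ) .{{_ : NonZero n}} → Vertex n → Vertex n → Bool
adjI n j k (inj₁ i) (inj₁ m) =
  ((toℕ i + j) % n ≡ᵇ toℕ m) ∨ ((toℕ m + j) % n ≡ᵇ toℕ i)
adjI n j k (inj₁ i) (inj₂ m) = toℕ i ≡ᵇ toℕ m
adjI n j k (inj₂ i) (inj₁ m) = toℕ i ≡ᵇ toℕ m
adjI n j k (inj₂ i) (inj₂ m) =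
  ((toℕ i + k) % n ≡ᵇ toℕ m) ∨ ((toℕ m + k) % n ≡ᵇ toℕ i)

adjMatI : (n j k : ℕ) .{{_ : NonZero n}} → Vertex n → Vertex n → ℚ
adjMatI n j k v w = if adjI n j k v w then 1ℚ else 0ℚ

IsEigenvalue : (n : ℕ) → (Vertex n → Vertex n → ℚ) → ℚ → Set
IsEigenvalue n M μ =
  Σ (Vertex n → ℚ) λ x →
    (∃ λ v → ¬ (x v ≡ 0ℚ)) ×
    ((v : Vertex n) → ΣV n (λ w → M v w *q x w) ≡ μ *q x v)

module Submission where

-- A vector x on the vertices is read as two n-periodic sequences a, b (the values
-- on the a- and b-vertices); x lies in the kernel of the adjacency matrix iff
--   a(t+j) + a(t-j) + b(t) = 0   and   a(t) + b(t+2j) + b(t-2j) = 0   for all t.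
-- Along an orbit t₀ + mj these equations give the recurrence
--   u(m+6) + u(m+4) - u(m+3) + u(m+2) + u(m) = 0,
-- whose characteristic polynomial is (x²+x+1)(x⁴-x³+x²-x+1) = Φ₃ Φ₁₀.
-- The orbit is periodic with period q = n / gcd(n, j); unless 3 ∣ q or 10 ∣ q,
-- periodicity forces the Φ₃-part and then the Φ₁₀-part to vanish, so x = 0.
-- If p ∣ q (p = 3 or 10) the numbers l = q/p and r = (j/gcd)/p satisfy one of the
-- six conditions (the residue of j/gcd mod p is a unit).  Conversely, from a condition
-- p j l = n (c + p r) we build an explicit kernel vector by sampling a fixed
-- p-periodic pattern of ±1's and 0's at the phase ⌊t p l / n⌋ mod p.

open import Defs
open import Data.Nat
  using (ℕ; zero; suc; _+_; _*_; _∸_; _≤_; _<_; _≡ᵇ_; NonZero; ≢-nonZero; ≢-nonZero⁻¹;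
         >-nonZero⁻¹; z≤n; s≤s; s<s⁻¹)
open import Data.Nat.Properties
open import Data.Nat.DivMod
open import Data.Nat.Divisibility
  using (_∣_; divides; _∣?_; ∣-trans; >⇒∤; ∣n∣m%n⇒∣m; n∣m*n)
open import Data.Nat.GCD using (gcd; gcd-GCD; gcd[m,n]∣m; gcd[m,n]∣n; gcd[m,n]≢0; m/gcd[m,n]≢0; module Bézout)
open import Data.Nat.Coprimality using (Coprime; coprime-/gcd)
open import Data.Nat.Tactic.RingSolver using (solve-∀)
open import Data.Bool using (Bool; true; false; _∨_; if_then_else_; T)
open import Data.Empty using (⊥-elim)
open import Data.Unit using (tt)
open import Data.Fin using (Fin; toℕ; fromℕ<)
import Data.Fin as F
open import Data.Fin.Properties using (toℕ-injective; toℕ-fromℕ<; toℕ<n; fromℕ<-toℕ; all?)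
open import Data.Integer using () renaming (+_ to +ℤ)
open import Data.Product using (Σ; _×_; _,_; proj₁; proj₂)
open import Data.Sum using (_⊎_; inj₁; inj₂)
open import Data.Rational using (ℚ; 0ℚ; 1ℚ)
  renaming (_+_ to _+q_; _*_ to _*q_; -_ to -q_; _-_ to _-q_; _/_ to _/q_)
import Data.Rational.Properties as ℚP
open import Data.Rational.Solver using (module +-*-Solver)
open +-*-Solver using (solve; _:+_; _:-_; _:*_; :-_; _:=_; con)
open import Function using (_∘_)
open import Function.Bundles using (_⇔_; mk⇔)
open import Relation.Binary.PropositionalEquality
open import Relation.Nullary using (¬_; Dec; yes; no)
open import Relation.Nullary.Decidable using (from-yes; from-no)

-- The 0/1 value of a boolean: adjMatI n j k v w is definitionally [ adjI n j k v w ]b.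
[_]b : Bool → ℚ
[ b ]b = if b then 1ℚ else 0ℚ

ΣFin-cong : ∀ n {f g : Fin n → ℚ} → (∀ i → f i ≡ g i) → ΣFin n f ≡ ΣFin n g
ΣFin-cong zero    e = refl
ΣFin-cong (suc n) e = cong₂ _+q_ (e F.zero) (ΣFin-cong n (e ∘ F.suc))

ΣFin-zero : ∀ n {f : Fin n → ℚ} → (∀ i → f i ≡ 0ℚ) → ΣFin n f ≡ 0ℚ
ΣFin-zero zero    e = refl
ΣFin-zero (suc n) e = cong₂ _+q_ (e F.zero) (ΣFin-zero n (e ∘ F.suc))

ΣFin-+ : ∀ n (f g : Fin n → ℚ) → ΣFin n (λ i → f i +q g i) ≡ ΣFin n f +q ΣFin n g
ΣFin-+ zero    f g = refl
ΣFin-+ (suc n) f g =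
  trans (cong (f F.zero +q g F.zero +q_) (ΣFin-+ n (f ∘ F.suc) (g ∘ F.suc)))
        (interchange (f F.zero) (g F.zero) (ΣFin n (f ∘ F.suc)) (ΣFin n (g ∘ F.suc)))
  where
  interchange : ∀ a b c d → (a +q b) +q (c +q d) ≡ (a +q c) +q (b +q d)
  interchange = solve 4 (λ a b c d → (a :+ b) :+ (c :+ d) := (a :+ c) :+ (b :+ d)) refl

ΣFin-select : ∀ n d .(d<n : d < n) (f : Fin n → ℚ) →
  ΣFin n (λ m → [ d ≡ᵇ toℕ m ]b *q f m) ≡ f (fromℕ< d<n)
ΣFin-select (suc n) zero d<n f =
  trans (cong₂ _+q_ (ℚP.*-identityˡ (f F.zero)) (ΣFin-zero n (λ i → ℚP.*-zeroˡ (f (F.suc i)))))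
        (ℚP.+-identityʳ _)
ΣFin-select (suc n) (suc d) d<n f =
  trans (cong₂ _+q_ (ℚP.*-zeroˡ (f F.zero)) (ΣFin-select n d (s<s⁻¹ d<n) (f ∘ F.suc)))
        (ℚP.+-identityˡ _)

[∨]b-split : ∀ a b (y : ℚ) → ¬ (a ≡ true × b ≡ true) →
  [ a ∨ b ]b *q y ≡ [ a ]b *q y +q [ b ]b *q y
[∨]b-split true  true  y excl = ⊥-elim (excl (refl , refl))
[∨]b-split true  false y excl = sym (trans (cong (1ℚ *q y +q_) (ℚP.*-zeroˡ y)) (ℚP.+-identityʳ _))
[∨]b-split false true  y excl = sym (trans (cong (_+q 1ℚ *q y) (ℚP.*-zeroˡ y)) (ℚP.+-identityˡ _))
[∨]b-split false false y excl = sym (trans (cong (_+q 0ℚ *q y) (ℚP.*-zeroˡ y)) (ℚP.+-identityˡ _))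

≡ᵇ-cong : ∀ a b c d → (a ≡ b → c ≡ d) → (c ≡ d → a ≡ b) → (a ≡ᵇ b) ≡ (c ≡ᵇ d)
≡ᵇ-cong a b c d to from with a ≡ᵇ b in e₁ | c ≡ᵇ d in e₂
... | true  | true  = refl
... | false | false = refl
... | true  | false = ⊥-elim (subst T e₂ (≡⇒≡ᵇ c d (to (≡ᵇ⇒≡ a b (subst T (sym e₁) tt)))))
... | false | true  = ⊥-elim (subst T e₁ (≡⇒≡ᵇ a b (from (≡ᵇ⇒≡ c d (subst T (sym e₂) tt)))))

T-≡ᵇ : ∀ {a b} → (a ≡ᵇ b) ≡ true → a ≡ b
T-≡ᵇ {a} {b} e = ≡ᵇ⇒≡ a b (subst T (sym e) tt)

%-absorbˡ : ∀ a b n .{{_ : NonZero n}} → (a % n + b) % n ≡ (a + b) % n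
%-absorbˡ a b n = trans (%-distribˡ-+ (a % n) b n)
  (trans (cong (λ z → (z + b % n) % n) (m%n%n≡m%n a n)) (sym (%-distribˡ-+ a b n)))

full-turn : ∀ {n} .{{_ : NonZero n}} α β x → α + β ≡ n → x < n → ((x + α) % n + β) % n ≡ x
full-turn {n} α β x α+β≡n x<n = begin
  ((x + α) % n + β) % n ≡⟨ %-absorbˡ (x + α) β n ⟩
  (x + α + β) % n       ≡⟨ cong (_% n) (trans (+-assoc x α β) (cong (x +_) α+β≡n)) ⟩
  (x + n) % n           ≡⟨ [m+n]%n≡m%n x n ⟩
  x % n                 ≡⟨ m<n⇒m%n≡m x<n ⟩
  x                     ∎
  where open ≡-Reasoning

no-short-turn : ∀ {n} .{{_ : NonZero n}} x δ → 0 < δ → δ < n → ¬ ((x + δ) % n ≡ x)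
no-short-turn {n} x δ 0<δ δ<n returns with (x + δ) / n | m≡m%n+[m/n]*n (x + δ) n
... | zero  | e = <⇒≢ 0<δ (sym (+-cancelˡ-≡ x δ 0
                     (trans e (cong (_+ 0) returns))))
... | suc k | e = <⇒≱ δ<n (≤-trans (m≤m+n n (k * n)) (≤-reflexive (sym (+-cancelˡ-≡ x δ _
                     (trans e (cong (_+ (n + k * n)) returns))))))

module Residues (n : ℕ) .{{_ : NonZero n}} where

  fin : ℕ → Fin n
  fin t = fromℕ< (m%n<n t n)

  toℕ-fin : ∀ t → toℕ (fin t) ≡ t % n
  toℕ-fin t = toℕ-fromℕ< _

  fin-cong : ∀ {t u} → t % n ≡ u % n → fin t ≡ fin u
  fin-cong e = toℕ-injective (trans (toℕ-fin _) (trans e (sym (toℕ-fin _))))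

  fin-toℕ : (i : Fin n) → fin (toℕ i) ≡ i
  fin-toℕ i = toℕ-injective (trans (toℕ-fin _) (m<n⇒m%n≡m (toℕ<n i)))

  module Cycle (s : ℕ) (0<s : 0 < s) (s+s<n : s + s < n) where

    s≤n : s ≤ n
    s≤n = ≤-trans (m≤m+n s s) (<⇒≤ s+s<n)

    forward-backward : ∀ m c → m < n → (m + s) % n ≡ c → (c + (n ∸ s)) % n ≡ m
    forward-backward m c m<n refl = full-turn s (n ∸ s) m (m+[n∸m]≡n s≤n) m<n

    backward-forward : ∀ m c → c < n → (c + (n ∸ s)) % n ≡ m → (m + s) % n ≡ c
    backward-forward m c c<n refl = full-turn (n ∸ s) s c (m∸n+n≡m s≤n) c<n

    neighbours-distinct : ∀ c → c < n → ¬ ((c + s) % n ≡ (c + (n ∸ s)) % n)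
    neighbours-distinct c c<n e = no-short-turn c (s + s) (<-≤-trans 0<s (m≤m+n s s)) s+s<n (begin
      (c + (s + s)) % n       ≡⟨ cong (_% n) (sym (+-assoc c s s)) ⟩
      (c + s + s) % n         ≡⟨ sym (%-absorbˡ (c + s) s n) ⟩
      ((c + s) % n + s) % n   ≡⟨ cong (λ z → (z + s) % n) e ⟩
      ((c + (n ∸ s)) % n + s) % n ≡⟨ backward-forward _ c c<n refl ⟩
      c                       ∎)
      where open ≡-Reasoning

    cycle-row : (c : Fin n) (f : Fin n → ℚ) →
      ΣFin n (λ m → [ ((toℕ c + s) % n ≡ᵇ toℕ m) ∨ ((toℕ m + s) % n ≡ᵇ toℕ c) ]b *q f m)
        ≡ f (fin (toℕ c + s)) +q f (fin (toℕ c + (n ∸ s)))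
    cycle-row c f = begin
      ΣFin n (λ m → [ plus m ∨ minus' m ]b *q f m)
        ≡⟨ ΣFin-cong n split ⟩
      ΣFin n (λ m → [ plus m ]b *q f m +q [ minus m ]b *q f m)
        ≡⟨ ΣFin-+ n _ _ ⟩
      ΣFin n (λ m → [ plus m ]b *q f m) +q ΣFin n (λ m → [ minus m ]b *q f m)
        ≡⟨ cong₂ _+q_ (ΣFin-select n _ (m%n<n (toℕ c + s) n) f)
                       (ΣFin-select n _ (m%n<n (toℕ c + (n ∸ s)) n) f) ⟩
      f (fin (toℕ c + s)) +q f (fin (toℕ c + (n ∸ s))) ∎
      where
      open ≡-Reasoning
      plus minus minus' : Fin n → Bool
      plus   m = (toℕ c + s) % n ≡ᵇ toℕ m
      minus  m = (toℕ c + (n ∸ s)) % n ≡ᵇ toℕ m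
      minus' m = (toℕ m + s) % n ≡ᵇ toℕ c
      split : ∀ m → [ plus m ∨ minus' m ]b *q f m ≡ [ plus m ]b *q f m +q [ minus m ]b *q f m
      split m rewrite ≡ᵇ-cong _ _ _ _ (forward-backward (toℕ m) (toℕ c) (toℕ<n m))
                                      (backward-forward (toℕ m) (toℕ c) (toℕ<n c)) =
        [∨]b-split (plus m) (minus m) (f m) λ (e₁ , e₂) →
          neighbours-distinct (toℕ c) (toℕ<n c) (trans (T-≡ᵇ e₁) (sym (T-≡ᵇ e₂)))

-- f has period P; only forward shifts are used, so no integers are needed.
Per : (ℕ → ℚ) → ℕ → Set
Per f P = ∀ m → f (P + m) ≡ f m

per-mult : ∀ {f P} → Per f P → ∀ k m → f (k * P + m) ≡ f m
per-mult         pf zero    m = refl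
per-mult {f} {P} pf (suc k) m =
  trans (cong f (+-assoc P (k * P) m)) (trans (pf (k * P + m)) (per-mult pf k m))

per-reduce : ∀ {f P} .{{_ : NonZero P}} → Per f P → ∀ m → f (m % P) ≡ f m
per-reduce {f} {P} pf m = trans (sym (per-mult pf (m / P) (m % P)))
  (cong f (trans (+-comm (m / P * P) (m % P)) (sym (m≡m%n+[m/n]*n m P))))

per-translate : ∀ {f P} → Per f P → ∀ c → Per (λ t → f (t + c)) P
per-translate {f} {P} pf c t = trans (cong f (+-assoc P t c)) (pf (t + c))

per-back : ∀ {f P} → Per f P → ∀ s → s ≤ P → ∀ t → f (t + s + (P ∸ s)) ≡ f t
per-back {f} {P} pf s s≤P t = trans (cong f (begin
  t + s + (P ∸ s)   ≡⟨ +-assoc t s (P ∸ s) ⟩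
  t + (s + (P ∸ s)) ≡⟨ cong (t +_) (m+[n∸m]≡n s≤P) ⟩
  t + P             ≡⟨ +-comm t P ⟩
  P + t             ∎)) (pf t)
  where open ≡-Reasoning

regroup : ∀ g z m → z + (g + m) ≡ g + z + m
regroup = solve-∀

-- Two periods give their gcd as a period (via Bézout's identity g + y b = x a).
per-gcd : ∀ {f a b} → Per f a → Per f b → Per f (gcd a b)
per-gcd {f} {a} {b} pa pb m with Bézout.identity (gcd-GCD a b)
... | Bézout.+- x y eq = begin
  f (gcd a b + m)           ≡⟨ sym (per-mult pb y _) ⟩
  f (y * b + (gcd a b + m)) ≡⟨ cong f (trans (regroup (gcd a b) (y * b) m) (cong (_+ m) eq)) ⟩
  f (x * a + m)             ≡⟨ per-mult pa x m ⟩
  f m                       ∎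
  where open ≡-Reasoning
... | Bézout.-+ x y eq = begin
  f (gcd a b + m)           ≡⟨ sym (per-mult pa x _) ⟩
  f (x * a + (gcd a b + m)) ≡⟨ cong f (trans (regroup (gcd a b) (x * a) m) (cong (_+ m) eq)) ⟩
  f (y * b + m)             ≡⟨ per-mult pb y m ⟩
  f m                       ∎
  where open ≡-Reasoning

-- The equations saying that the adjacency matrix of I(n, j, k) kills the vector
-- with values a(t) at a_t and b(t) at b_t: each vertex sees the sum over its neighbours.
KernelEqs : ℕ → ℕ → ℕ → (ℕ → ℚ) → (ℕ → ℚ) → Set
KernelEqs n j k a b = (∀ t → a (t + j) +q a (t + (n ∸ j)) +q b t ≡ 0ℚ)
                    × (∀ t → a t +q (b (t + k) +q b (t + (n ∸ k))) ≡ 0ℚ)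

module IGraph (n : ℕ) .{{_ : NonZero n}} (j k : ℕ) where
  open Residues n

  Represents : (Vertex n → ℚ) → (ℕ → ℚ) → (ℕ → ℚ) → Set
  Represents x a b = (∀ t → x (inj₁ (fin t)) ≡ a t) × (∀ t → x (inj₂ (fin t)) ≡ b t)

  InKernel : (Vertex n → ℚ) → Set
  InKernel x = (v : Vertex n) → ΣV n (λ w → adjMatI n j k v w *q x w) ≡ 0ℚ *q x v

  module Represented {x : Vertex n → ℚ} {a b : ℕ → ℚ} (rep : Represents x a b) where
    private
      rep-a = proj₁ rep
      rep-b = proj₂ rep

    at-a : ∀ i → x (inj₁ i) ≡ a (toℕ i)
    at-a i = trans (cong (x ∘ inj₁) (sym (fin-toℕ i))) (rep-a (toℕ i))

    at-b : ∀ i → x (inj₂ i) ≡ b (toℕ i)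
    at-b i = trans (cong (x ∘ inj₂) (sym (fin-toℕ i))) (rep-b (toℕ i))

    a-cong : ∀ {t u} → t % n ≡ u % n → a t ≡ a u
    a-cong e = trans (sym (rep-a _)) (trans (cong (x ∘ inj₁) (fin-cong e)) (rep-a _))

    b-cong : ∀ {t u} → t % n ≡ u % n → b t ≡ b u
    b-cong e = trans (sym (rep-b _)) (trans (cong (x ∘ inj₂) (fin-cong e)) (rep-b _))

    represented-periodic : Per a n × Per b n
    represented-periodic = (λ t → a-cong (n+t≡t)) , (λ t → b-cong (n+t≡t))
      where
      n+t≡t : ∀ {t} → (n + t) % n ≡ t % n
      n+t≡t {t} = trans (cong (_% n) (+-comm n t)) ([m+n]%n≡m%n t n)

  sample : (ℕ → ℚ) → (ℕ → ℚ) → Vertex n → ℚ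
  sample a b (inj₁ i) = a (toℕ i)
  sample a b (inj₂ i) = b (toℕ i)

  sample-represents : ∀ {a b} → Per a n → Per b n → Represents (sample a b) a b
  sample-represents {a} {b} pa pb =
    (λ t → trans (cong a (toℕ-fin t)) (per-reduce pa t)) ,
    (λ t → trans (cong b (toℕ-fin t)) (per-reduce pb t))

  module Rows (0<j : 0 < j) (j+j<n : j + j < n) (0<k : 0 < k) (k+k<n : k + k < n)
              {x : Vertex n → ℚ} {a b : ℕ → ℚ} (rep : Represents x a b) where
    open Represented {x} {a} {b} rep

    row-a : (i : Fin n) →
      ΣV n (λ w → adjMatI n j k (inj₁ i) w *q x w) ≡ a (toℕ i + j) +q a (toℕ i + (n ∸ j)) +q b (toℕ i)
    row-a i = cong₂ _+q_
      (trans (Cycle.cycle-row j 0<j j+j<n i (x ∘ inj₁)) (cong₂ _+q_ (proj₁ rep _) (proj₁ rep _)))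
      (trans (ΣFin-select n (toℕ i) (toℕ<n i) (x ∘ inj₂))
             (trans (cong (x ∘ inj₂) (fromℕ<-toℕ i _)) (at-b i)))

    row-b : (i : Fin n) →
      ΣV n (λ w → adjMatI n j k (inj₂ i) w *q x w) ≡ a (toℕ i) +q (b (toℕ i + k) +q b (toℕ i + (n ∸ k)))
    row-b i = cong₂ _+q_
      (trans (ΣFin-select n (toℕ i) (toℕ<n i) (x ∘ inj₁))
             (trans (cong (x ∘ inj₁) (fromℕ<-toℕ i _)) (at-a i)))
      (trans (Cycle.cycle-row k 0<k k+k<n i (x ∘ inj₂)) (cong₂ _+q_ (proj₂ rep _) (proj₂ rep _)))

    kernel⇒eqs : InKernel x → KernelEqs n j k a b
    kernel⇒eqs ker = eq-a , eq-b
      where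
      shifted : ∀ t u → (toℕ (fin t) + u) % n ≡ (t + u) % n
      shifted t u = trans (cong (λ z → (z + u) % n) (toℕ-fin t)) (%-absorbˡ t u n)
      reduced : ∀ t → toℕ (fin t) % n ≡ t % n
      reduced t = trans (cong (_% n) (toℕ-fin t)) (m%n%n≡m%n t n)
      eq-a : ∀ t → a (t + j) +q a (t + (n ∸ j)) +q b t ≡ 0ℚ
      eq-a t = trans
        (sym (cong₂ _+q_ (cong₂ _+q_ (a-cong (shifted t j)) (a-cong (shifted t (n ∸ j))))
                         (b-cong (reduced t))))
        (trans (sym (row-a (fin t))) (trans (ker (inj₁ (fin t))) (ℚP.*-zeroˡ (x (inj₁ (fin t))))))
      eq-b : ∀ t → a t +q (b (t + k) +q b (t + (n ∸ k))) ≡ 0ℚ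
      eq-b t = trans
        (sym (cong₂ _+q_ (a-cong (reduced t))
                         (cong₂ _+q_ (b-cong (shifted t k)) (b-cong (shifted t (n ∸ k))))))
        (trans (sym (row-b (fin t))) (trans (ker (inj₂ (fin t))) (ℚP.*-zeroˡ (x (inj₂ (fin t))))))

    eqs⇒kernel : KernelEqs n j k a b → InKernel x
    eqs⇒kernel (eq-a , eq-b) (inj₁ i) = trans (row-a i) (trans (eq-a (toℕ i)) (sym (ℚP.*-zeroˡ (x (inj₁ i)))))
    eqs⇒kernel (eq-a , eq-b) (inj₂ i) = trans (row-b i) (trans (eq-b (toℕ i)) (sym (ℚP.*-zeroˡ (x (inj₂ i)))))

divisor-of-3 : ∀ {d} → d ∣ 3 → d ≡ 1 ⊎ d ≡ 3
divisor-of-3 {0} d∣3 = ⊥-elim (from-no (0 ∣? 3) d∣3)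
divisor-of-3 {1} _   = inj₁ refl
divisor-of-3 {2} d∣3 = ⊥-elim (from-no (2 ∣? 3) d∣3)
divisor-of-3 {3} _   = inj₂ refl
divisor-of-3 {suc (suc (suc (suc d)))} d∣3 = ⊥-elim (>⇒∤ (s≤s (s≤s (s≤s (s≤s z≤n)))) d∣3)

divisor-of-10 : ∀ {d} → d ∣ 10 → d ≡ 1 ⊎ d ≡ 2 ⊎ d ≡ 5 ⊎ d ≡ 10
divisor-of-10 {0}  d∣10 = ⊥-elim (from-no (0 ∣? 10) d∣10)
divisor-of-10 {1}  _    = inj₁ refl
divisor-of-10 {2}  _    = inj₂ (inj₁ refl)
divisor-of-10 {3}  d∣10 = ⊥-elim (from-no (3 ∣? 10) d∣10)
divisor-of-10 {4}  d∣10 = ⊥-elim (from-no (4 ∣? 10) d∣10)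
divisor-of-10 {5}  _    = inj₂ (inj₂ (inj₁ refl))
divisor-of-10 {6}  d∣10 = ⊥-elim (from-no (6 ∣? 10) d∣10)
divisor-of-10 {7}  d∣10 = ⊥-elim (from-no (7 ∣? 10) d∣10)
divisor-of-10 {8}  d∣10 = ⊥-elim (from-no (8 ∣? 10) d∣10)
divisor-of-10 {9}  d∣10 = ⊥-elim (from-no (9 ∣? 10) d∣10)
divisor-of-10 {10} _    = inj₂ (inj₂ (inj₂ refl))
divisor-of-10 {suc (suc (suc (suc (suc (suc (suc (suc (suc (suc (suc d))))))))))} d∣10 =
  ⊥-elim (>⇒∤ (s≤s (s≤s (s≤s (s≤s (s≤s (s≤s (s≤s (s≤s (s≤s (s≤s (s≤s z≤n))))))))))) d∣10)

gcd-with-3 : ∀ q → ¬ 3 ∣ q → gcd q 3 ≡ 1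
gcd-with-3 q 3∤q with divisor-of-3 (gcd[m,n]∣n q 3)
... | inj₁ g≡1 = g≡1
... | inj₂ g≡3 = ⊥-elim (3∤q (subst (_∣ q) g≡3 (gcd[m,n]∣m q 3)))

gcd-with-10 : ∀ q → ¬ 10 ∣ q → gcd q 10 ≡ 1 ⊎ gcd q 10 ≡ 2 ⊎ gcd q 10 ≡ 5
gcd-with-10 q 10∤q with divisor-of-10 (gcd[m,n]∣n q 10)
... | inj₁ g≡1 = inj₁ g≡1
... | inj₂ (inj₁ g≡2) = inj₂ (inj₁ g≡2)
... | inj₂ (inj₂ (inj₁ g≡5)) = inj₂ (inj₂ g≡5)
... | inj₂ (inj₂ (inj₂ g≡10)) = ⊥-elim (10∤q (subst (_∣ q) g≡10 (gcd[m,n]∣m q 10)))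

thrice-zero : ∀ a → a +q a +q a ≡ 0ℚ → a ≡ 0ℚ
thrice-zero a e = trans (solve 1 (λ a → a := (a :+ a :+ a) :* con (+ℤ 1 /q 3)) refl a)
                        (cong (_*q (+ℤ 1 /q 3)) e)

self-negative-zero : ∀ a → a ≡ -q a → a ≡ 0ℚ
self-negative-zero a e = trans (solve 1 (λ a → a := (a :+ a) :* con (+ℤ 1 /q 2)) refl a)
  (cong (_*q (+ℤ 1 /q 2)) (trans (cong (a +q_) e) (ℚP.+-inverseʳ a)))

fivefold-zero : ∀ a → a -q (-q a) +q a -q (-q a) +q a ≡ 0ℚ → a ≡ 0ℚ
fivefold-zero a e = trans
  (solve 1 (λ a → a := (a :- (:- a) :+ a :- (:- a) :+ a) :* con (+ℤ 1 /q 5)) refl a)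
  (cong (_*q (+ℤ 1 /q 5)) e)

-- The cyclotomic polynomials Φ₃ = x²+x+1 and Φ₁₀ = x⁴-x³+x²-x+1 acting by shifts.
cyclo3 : (ℕ → ℚ) → ℕ → ℚ
cyclo3 w m = w (2 + m) +q w (1 + m) +q w m

cyclo10 : (ℕ → ℚ) → ℕ → ℚ
cyclo10 u m = u (4 + m) -q u (3 + m) +q u (2 + m) -q u (1 + m) +q u m

orbit-recurrence : ∀ (u v : ℕ → ℚ) →
  (∀ m → u (2 + m) +q u m +q v (1 + m) ≡ 0ℚ) →
  (∀ m → u (2 + m) +q (v (4 + m) +q v m) ≡ 0ℚ) →
  ∀ m → cyclo3 (cyclo10 u) m ≡ 0ℚ
orbit-recurrence u v eq₁ eq₂ m = begin
  cyclo3 (cyclo10 u) m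
    ≡⟨ combination (u m) (u (1 + m)) (u (2 + m)) (u (3 + m)) (u (4 + m)) (u (5 + m)) (u (6 + m))
                   (v (1 + m)) (v (5 + m)) ⟩
  (u (2 + m) +q u m +q v (1 + m)) +q (u (6 + m) +q u (4 + m) +q v (5 + m))
    -q (u (3 + m) +q (v (5 + m) +q v (1 + m)))
    ≡⟨ cong₂ _-q_ (cong₂ _+q_ (eq₁ m) (eq₁ (4 + m))) (eq₂ (1 + m)) ⟩
  0ℚ ∎
  where
  open ≡-Reasoning
  combination : ∀ u₀ u₁ u₂ u₃ u₄ u₅ u₆ v₁ v₅ →
    (u₆ -q u₅ +q u₄ -q u₃ +q u₂) +q (u₅ -q u₄ +q u₃ -q u₂ +q u₁) +q (u₄ -q u₃ +q u₂ -q u₁ +q u₀)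
      ≡ (u₂ +q u₀ +q v₁) +q (u₆ +q u₄ +q v₅) -q (u₃ +q (v₅ +q v₁))
  combination = solve 9 (λ u₀ u₁ u₂ u₃ u₄ u₅ u₆ v₁ v₅ →
    (u₆ :- u₅ :+ u₄ :- u₃ :+ u₂) :+ (u₅ :- u₄ :+ u₃ :- u₂ :+ u₁) :+ (u₄ :- u₃ :+ u₂ :- u₁ :+ u₀)
      := (u₂ :+ u₀ :+ v₁) :+ (u₆ :+ u₄ :+ v₅) :- (u₃ :+ (v₅ :+ v₁))) refl

per-ahead : ∀ {f P} → Per f P → ∀ k m → f (k + (P + m)) ≡ f (k + m)
per-ahead {f} {P} pf k m = trans (cong f (trans (sym (+-assoc k P m))
  (trans (cong (_+ m) (+-comm k P)) (+-assoc P k m)))) (pf (k + m))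

cyclo10-per : ∀ {u q} → Per u q → Per (cyclo10 u) q
cyclo10-per pu m = cong₂ _+q_ (cong₂ _-q_ (cong₂ _+q_ (cong₂ _-q_
  (per-ahead pu 4 m) (per-ahead pu 3 m)) (per-ahead pu 2 m)) (per-ahead pu 1 m)) (pu m)

-- Φ₃ w = 0 gives period 3; with a period q prime to 3, w is constant, hence 0.
cyclo3-vanishes : ∀ {w q} → (∀ m → cyclo3 w m ≡ 0ℚ) → Per w q → ¬ 3 ∣ q → ∀ m → w m ≡ 0ℚ
cyclo3-vanishes {w} {q} Φ₃w pq 3∤q m =
  thrice-zero (w m) (trans (sym (cong₂ (λ s t → s +q t +q w m)
    (trans (constant (1 + m)) (constant m)) (constant m))) (Φ₃w m))
  where
  period-3 : Per w 3
  period-3 m = begin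
    w (3 + m)
      ≡⟨ difference (w (3 + m)) (w (2 + m)) (w (1 + m)) (w m) ⟩
    cyclo3 w (1 + m) -q cyclo3 w m +q w m
      ≡⟨ cong₂ (λ s t → s -q t +q w m) (Φ₃w (1 + m)) (Φ₃w m) ⟩
    0ℚ -q 0ℚ +q w m
      ≡⟨ ℚP.+-identityˡ (w m) ⟩
    w m ∎
    where
    open ≡-Reasoning
    difference : ∀ w₃ w₂ w₁ w₀ → w₃ ≡ w₃ +q w₂ +q w₁ -q (w₂ +q w₁ +q w₀) +q w₀
    difference = solve 4 (λ w₃ w₂ w₁ w₀ → w₃ := w₃ :+ w₂ :+ w₁ :- (w₂ :+ w₁ :+ w₀) :+ w₀) refl
  constant : Per w 1
  constant = subst (Per w) (gcd-with-3 q 3∤q) (per-gcd pq period-3)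

-- Φ₁₀ u = 0 gives u(m+5) = -u(m), hence period 10; with a period q not divisible
-- by 10, the gcd is 1, 2 or 5 and each case forces u = 0.
cyclo10-vanishes : ∀ {u q} → (∀ m → cyclo10 u m ≡ 0ℚ) → Per u q → ¬ 10 ∣ q → ∀ m → u m ≡ 0ℚ
cyclo10-vanishes {u} {q} Φ₁₀u pq 10∤q = by-gcd (gcd-with-10 q 10∤q)
  where
  antiperiodic : ∀ m → u (5 + m) ≡ -q u m
  antiperiodic m = begin
    u (5 + m)
      ≡⟨ telescope (u m) (u (1 + m)) (u (2 + m)) (u (3 + m)) (u (4 + m)) (u (5 + m)) ⟩
    cyclo10 u (1 + m) +q cyclo10 u m -q u m
      ≡⟨ cong₂ (λ s t → s +q t -q u m) (Φ₁₀u (1 + m)) (Φ₁₀u m) ⟩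
    0ℚ +q 0ℚ -q u m
      ≡⟨ ℚP.+-identityˡ (-q u m) ⟩
    -q u m ∎
    where
    open ≡-Reasoning
    telescope : ∀ u₀ u₁ u₂ u₃ u₄ u₅ →
      u₅ ≡ (u₅ -q u₄ +q u₃ -q u₂ +q u₁) +q (u₄ -q u₃ +q u₂ -q u₁ +q u₀) -q u₀
    telescope = solve 6 (λ u₀ u₁ u₂ u₃ u₄ u₅ →
      u₅ := (u₅ :- u₄ :+ u₃ :- u₂ :+ u₁) :+ (u₄ :- u₃ :+ u₂ :- u₁ :+ u₀) :- u₀) refl
  period-10 : Per u 10
  period-10 m = trans (antiperiodic (5 + m))
    (trans (cong -q_ (antiperiodic m)) (solve 1 (λ a → :- (:- a) := a) refl (u m)))
  period : ∀ {d} → gcd q 10 ≡ d → Per u d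
  period refl = per-gcd pq period-10
  from-period-5 : Per u 5 → ∀ m → u m ≡ 0ℚ
  from-period-5 p5 m = self-negative-zero (u m) (trans (sym (p5 m)) (antiperiodic m))
  from-period-2 : Per u 2 → ∀ m → u m ≡ 0ℚ
  from-period-2 p2 m = collapse (trans (p2 (2 + m)) (p2 m)) (p2 (1 + m)) (p2 m)
    (trans (sym (trans (p2 (3 + m)) (p2 (1 + m)))) (antiperiodic m)) (Φ₁₀u m)
    where
    collapse : ∀ {a b c d e} → e ≡ a → d ≡ b → c ≡ a → b ≡ -q a →
               e -q d +q c -q b +q a ≡ 0ℚ → a ≡ 0ℚ
    collapse refl refl refl refl = fivefold-zero _
  by-gcd : gcd q 10 ≡ 1 ⊎ gcd q 10 ≡ 2 ⊎ gcd q 10 ≡ 5 → ∀ m → u m ≡ 0ℚ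
  by-gcd (inj₁ g≡1)        = from-period-5 (per-mult (period g≡1) 5)
  by-gcd (inj₂ (inj₁ g≡2)) = from-period-2 (period g≡2)
  by-gcd (inj₂ (inj₂ g≡5)) = from-period-5 (period g≡5)

orbit-vanishes : ∀ (u v : ℕ → ℚ) {q} →
  (∀ m → u (2 + m) +q u m +q v (1 + m) ≡ 0ℚ) →
  (∀ m → u (2 + m) +q (v (4 + m) +q v m) ≡ 0ℚ) →
  Per u q → ¬ 3 ∣ q → ¬ 10 ∣ q → ∀ m → u m ≡ 0ℚ
orbit-vanishes u v eq₁ eq₂ pq 3∤q 10∤q =
  cyclo10-vanishes (cyclo3-vanishes (orbit-recurrence u v eq₁ eq₂) (cyclo10-per pq) 3∤q) pq 10∤q

Disjuncts : ℕ → ℕ → ℕ → ℕ → Set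
Disjuncts n j l r =
  (3 * j * l ≡ n * (1 + 3 * r)) ⊎ (3 * j * l ≡ n * (2 + 3 * r)) ⊎
  (10 * j * l ≡ n * (1 + 10 * r)) ⊎ (10 * j * l ≡ n * (3 + 10 * r)) ⊎
  (10 * j * l ≡ n * (7 + 10 * r)) ⊎ (10 * j * l ≡ n * (9 + 10 * r))

Condition : ℕ → ℕ → Set
Condition n j = Σ ℕ λ l → l < n × Σ ℕ λ r → Disjuncts n j l r

common-divisor : ∀ {c p} d → suc (suc d) ∣ c → suc (suc d) ∣ p → ¬ Coprime c p
common-divisor d d∣c d∣p coprime with coprime (d∣c , d∣p)
... | ()

-- The units modulo 3 are 1 and 2 …
select-3 : ∀ {n j l r c} → c < 3 → Coprime c 3 → 3 * j * l ≡ n * (c + 3 * r) → Disjuncts n j l r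
select-3 {c = 0} _ coprime e = ⊥-elim (common-divisor 1 (divides 0 refl) (divides 1 refl) coprime)
select-3 {c = 1} _ _ e = inj₁ e
select-3 {c = 2} _ _ e = inj₂ (inj₁ e)
select-3 {c = suc (suc (suc _))} (s≤s (s≤s (s≤s ()))) _ _

-- … and modulo 10 they are 1, 3, 7 and 9.
select-10 : ∀ {n j l r c} → c < 10 → Coprime c 10 → 10 * j * l ≡ n * (c + 10 * r) → Disjuncts n j l r
select-10 {c = 0} _ coprime e = ⊥-elim (common-divisor 0 (divides 0 refl) (divides 5 refl) coprime)
select-10 {c = 1} _ _ e = inj₂ (inj₂ (inj₁ e))
select-10 {c = 2} _ coprime e = ⊥-elim (common-divisor 0 (divides 1 refl) (divides 5 refl) coprime)
select-10 {c = 3} _ _ e = inj₂ (inj₂ (inj₂ (inj₁ e)))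
select-10 {c = 4} _ coprime e = ⊥-elim (common-divisor 0 (divides 2 refl) (divides 5 refl) coprime)
select-10 {c = 5} _ coprime e = ⊥-elim (common-divisor 3 (divides 1 refl) (divides 2 refl) coprime)
select-10 {c = 6} _ coprime e = ⊥-elim (common-divisor 0 (divides 3 refl) (divides 5 refl) coprime)
select-10 {c = 7} _ _ e = inj₂ (inj₂ (inj₂ (inj₂ (inj₁ e))))
select-10 {c = 8} _ coprime e = ⊥-elim (common-divisor 0 (divides 4 refl) (divides 5 refl) coprime)
select-10 {c = 9} _ _ e = inj₂ (inj₂ (inj₂ (inj₂ (inj₂ e))))
select-10 {c = suc (suc (suc (suc (suc (suc (suc (suc (suc (suc _)))))))))}
  (s≤s (s≤s (s≤s (s≤s (s≤s (s≤s (s≤s (s≤s (s≤s (s≤s ())))))))))) _ _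

-- q = n / gcd(n, j) is the length of the orbits of t ↦ t + j on ℤ/n, and q j = n j′.
module Reduced (n j : ℕ) .{{_ : NonZero n}} where

  g : ℕ
  g = gcd n j

  instance
    g≢0 : NonZero g
    g≢0 = ≢-nonZero (gcd[m,n]≢0 n j (inj₁ (≢-nonZero⁻¹ n)))

  q : ℕ
  q = n / g

  j′ : ℕ
  j′ = j / g

  orbit-length : q * j ≡ n * j′
  orbit-length = begin
    q * j        ≡⟨ cong (q *_) (sym (m*[n/m]≡n (gcd[m,n]∣n n j))) ⟩
    q * (g * j′) ≡⟨ sym (*-assoc q g j′) ⟩
    q * g * j′   ≡⟨ cong (_* j′) (m/n*n≡m (gcd[m,n]∣m n j)) ⟩
    n * j′       ∎
    where open ≡-Reasoning

  instance
    q≢0 : NonZero q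
    q≢0 = ≢-nonZero (m/gcd[m,n]≢0 n j)

  -- For a divisor p of q, put l = q/p, r = j′/p and c = j′ mod p.
  quotient-bound : ∀ p .{{_ : NonZero p}} → 1 < p → q / p < n
  quotient-bound p 1<p = <-≤-trans (m/n<m q p 1<p) (m/n≤m n g)

  divisor-equation : ∀ p .{{_ : NonZero p}} → p ∣ q → p * j * (q / p) ≡ n * (j′ % p + p * (j′ / p))
  divisor-equation p p∣q = begin
    p * j * (q / p)              ≡⟨ rearrange p j (q / p) ⟩
    j * (p * (q / p))            ≡⟨ cong (j *_) (m*[n/m]≡n p∣q) ⟩
    j * q                        ≡⟨ *-comm j q ⟩
    q * j                        ≡⟨ orbit-length ⟩
    n * j′                       ≡⟨ cong (n *_) (trans (m≡m%n+[m/n]*n j′ p) (cong (j′ % p +_) (*-comm (j′ / p) p))) ⟩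
    n * (j′ % p + p * (j′ / p))  ∎
    where
    open ≡-Reasoning
    rearrange : ∀ p j l → p * j * l ≡ j * (p * l)
    rearrange = solve-∀

  -- c is a unit mod p, because q and j′ are coprime.
  residue-coprime : ∀ p .{{_ : NonZero p}} → p ∣ q → Coprime (j′ % p) p
  residue-coprime p p∣q (d∣c , d∣p) = coprime-/gcd n j (∣-trans d∣p p∣q , ∣n∣m%n⇒∣m d∣p d∣c)

  condition-3 : 3 ∣ q → Condition n j
  condition-3 3∣q = q / 3 , quotient-bound 3 (s≤s (s≤s z≤n)) , j′ / 3 ,
    select-3 {n} {j} {q / 3} {j′ / 3} {j′ % 3}
      (m%n<n j′ 3) (residue-coprime 3 3∣q) (divisor-equation 3 3∣q)

  condition-10 : 10 ∣ q → Condition n j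
  condition-10 10∣q = q / 10 , quotient-bound 10 (s≤s (s≤s z≤n)) , j′ / 10 ,
    select-10 {n} {j} {q / 10} {j′ / 10} {j′ % 10}
      (m%n<n j′ 10) (residue-coprime 10 10∣q) (divisor-equation 10 10∣q)

module Bounds (n j : ℕ) (0<j : 0 < j) (4j<n : 4 * j < n) where

  2j+2j<n : 2 * j + 2 * j < n
  2j+2j<n = subst (_< n) (four j) 4j<n
    where
    four : ∀ j → 4 * j ≡ 2 * j + 2 * j
    four = solve-∀

  j+j<n : j + j < n
  j+j<n = ≤-<-trans (+-mono-≤ (m≤m+n j (j + 0)) (m≤m+n j (j + 0))) 2j+2j<n

  0<2j : 0 < 2 * j
  0<2j = ≤-trans 0<j (m≤m+n j (j + 0))

  j≤n : j ≤ n
  j≤n = ≤-trans (m≤m+n j j) (<⇒≤ j+j<n)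

  2j≤n : 2 * j ≤ n
  2j≤n = ≤-trans (m≤m+n (2 * j) (2 * j)) (<⇒≤ 2j+2j<n)

  3j≤n : 3 * j ≤ n
  3j≤n = ≤-trans (≤-reflexive (three j)) (≤-trans (+-monoʳ-≤ (2 * j) (m≤m+n j (j + 0))) (<⇒≤ 2j+2j<n))
    where
    three : ∀ j → 3 * j ≡ 2 * j + j
    three = solve-∀

module Orbit {n j : ℕ} {a b : ℕ → ℚ} (pa : Per a n) (pb : Per b n) (j≤n : j ≤ n) (2j≤n : 2 * j ≤ n)
             (eqs : KernelEqs n j (2 * j) a b) (t₀ : ℕ) where

  u v : ℕ → ℚ
  u m = a (m * j + t₀)
  v m = b (m * j + t₀)

  eq₁ : ∀ m → u (2 + m) +q u m +q v (1 + m) ≡ 0ℚ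
  eq₁ m = trans (sym (cong₂ (λ s s′ → s +q s′ +q v (1 + m)) ahead behind)) (proj₁ eqs ((1 + m) * j + t₀))
    where
    ahead : a ((1 + m) * j + t₀ + j) ≡ u (2 + m)
    ahead = cong a (step m j t₀)
      where step : ∀ m j t₀ → (1 + m) * j + t₀ + j ≡ (2 + m) * j + t₀
            step = solve-∀
    behind : a ((1 + m) * j + t₀ + (n ∸ j)) ≡ u m
    behind = trans (cong (λ s → a (s + (n ∸ j))) (step m j t₀)) (per-back pa j j≤n (m * j + t₀))
      where step : ∀ m j t₀ → (1 + m) * j + t₀ ≡ m * j + t₀ + j
            step = solve-∀

  eq₂ : ∀ m → u (2 + m) +q (v (4 + m) +q v m) ≡ 0ℚ
  eq₂ m = trans (sym (cong (u (2 + m) +q_) (cong₂ _+q_ ahead behind))) (proj₂ eqs ((2 + m) * j + t₀))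
    where
    ahead : b ((2 + m) * j + t₀ + 2 * j) ≡ v (4 + m)
    ahead = cong b (step m j t₀)
      where step : ∀ m j t₀ → (2 + m) * j + t₀ + 2 * j ≡ (4 + m) * j + t₀
            step = solve-∀
    behind : b ((2 + m) * j + t₀ + (n ∸ 2 * j)) ≡ v m
    behind = trans (cong (λ s → b (s + (n ∸ 2 * j))) (step m j t₀)) (per-back pb (2 * j) 2j≤n (m * j + t₀))
      where step : ∀ m j t₀ → (2 + m) * j + t₀ ≡ m * j + t₀ + 2 * j
            step = solve-∀

  period : ∀ {q j′} → q * j ≡ n * j′ → Per u q
  period {q} {j′} qj≡nj′ m = trans (cong a (begin
    (q + m) * j + t₀      ≡⟨ step q m j t₀ ⟩
    q * j + (m * j + t₀)  ≡⟨ cong (_+ (m * j + t₀)) (trans qj≡nj′ (*-comm n j′)) ⟩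
    j′ * n + (m * j + t₀) ∎)) (per-mult pa j′ (m * j + t₀))
    where
    open ≡-Reasoning
    step : ∀ q m j t₀ → (q + m) * j + t₀ ≡ q * j + (m * j + t₀)
    step = solve-∀

module EigenvalueToCondition (n j : ℕ) .{{_ : NonZero n}} (0<j : 0 < j) (4j<n : 4 * j < n) where
  open Residues n
  open IGraph n j (2 * j)
  open Reduced n j
  open Bounds n j 0<j 4j<n

  kernel-trivial : ¬ 3 ∣ q → ¬ 10 ∣ q → ∀ x → InKernel x → ∀ v → x v ≡ 0ℚ
  kernel-trivial 3∤q 10∤q x ker = vanishes
    where
    a b : ℕ → ℚ
    a t = x (inj₁ (fin t))
    b t = x (inj₂ (fin t))
    rep : Represents x a b
    rep = (λ _ → refl) , (λ _ → refl)
    open Represented {x} {a} {b} rep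
    eqs : KernelEqs n j (2 * j) a b
    eqs = Rows.kernel⇒eqs 0<j j+j<n 0<2j 2j+2j<n {x} rep ker
    module O = Orbit (proj₁ represented-periodic) (proj₂ represented-periodic) j≤n 2j≤n eqs
    a-zero : ∀ t → a t ≡ 0ℚ
    a-zero t = orbit-vanishes (O.u t) (O.v t) (O.eq₁ t) (O.eq₂ t) (O.period t {q} {j′} orbit-length) 3∤q 10∤q 0
    b-zero : ∀ t → b t ≡ 0ℚ
    b-zero t = begin
      b t                                     ≡⟨ sym (ℚP.+-identityˡ (b t)) ⟩
      0ℚ +q 0ℚ +q b t                         ≡⟨ cong₂ (λ s s′ → s +q s′ +q b t) (sym (a-zero _)) (sym (a-zero _)) ⟩
      a (t + j) +q a (t + (n ∸ j)) +q b t     ≡⟨ proj₁ eqs t ⟩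
      0ℚ                                      ∎
      where open ≡-Reasoning
    vanishes : ∀ v → x v ≡ 0ℚ
    vanishes (inj₁ i) = trans (at-a i) (a-zero (toℕ i))
    vanishes (inj₂ i) = trans (at-b i) (b-zero (toℕ i))

  eigenvalue⇒condition : IsEigenvalue n (adjMatI n j (2 * j)) 0ℚ → Condition n j
  eigenvalue⇒condition (x , (v , xv≢0) , ker) with 3 ∣? q | 10 ∣? q
  ... | yes 3∣q | _        = condition-3 3∣q
  ... | no _    | yes 10∣q = condition-10 10∣q
  ... | no 3∤q  | no 10∤q  = ⊥-elim (xv≢0 (kernel-trivial 3∤q 10∤q x ker v))

-- Once b(t) = -(a(t+j) + a(t-j)), the b-vertex equation reads
--   a(t) - a(t+3j) - a(t+j) - a(t-j) - a(t-3j) = 0;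
-- pattern-lhs is its left-hand side for a = φ sampled along the phases e + m c mod p
-- (m = 0, 2, 3, 4, 6 correspond to t - 3j, t - j, t, t + j, t + 3j).
pattern-lhs : (p : ℕ) .{{_ : NonZero p}} → ℕ → (ℕ → ℚ) → ℕ → ℚ
pattern-lhs p c φ e = Φ 3 +q (-q (Φ 6 +q Φ 4) +q -q (Φ 2 +q Φ 0))
  where
  Φ : ℕ → ℚ
  Φ m = φ ((e + m * c) % p)

PatternEq : (p : ℕ) .{{_ : NonZero p}} → ℕ → (ℕ → ℚ) → Set
PatternEq p c φ = (E : Fin p) → pattern-lhs p c φ (toℕ E) ≡ 0ℚ

-- PatternEq is decidable, so the concrete patterns below are checked by evaluation.
pattern? : (p : ℕ) .{{_ : NonZero p}} (c : ℕ) (φ : ℕ → ℚ) → Dec (PatternEq p c φ)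
pattern? p c φ = all? (λ E → _ ℚP.≟ _)

φ₃ : ℕ → ℚ
φ₃ 0 = 1ℚ
φ₃ 1 = -q 1ℚ
φ₃ _ = 0ℚ

φ₁₀ : ℕ → ℚ
φ₁₀ 0 = 1ℚ
φ₁₀ 1 = 1ℚ
φ₁₀ 5 = -q 1ℚ
φ₁₀ 6 = -q 1ℚ
φ₁₀ _ = 0ℚ

module Construction (n j : ℕ) .{{_ : NonZero n}} (0<j : 0 < j) (4j<n : 4 * j < n)
                    (p : ℕ) .{{_ : NonZero p}} (c r l : ℕ) (φ : ℕ → ℚ) (φ0≡1 : φ 0 ≡ 1ℚ)
                    (pattern-eq : PatternEq p c φ) (condition : p * j * l ≡ n * (c + p * r)) where
  open Residues n
  open IGraph n j (2 * j)
  open Bounds n j 0<j 4j<n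

  /-add-multiple : ∀ a k → (a + k * n) / n ≡ a / n + k
  /-add-multiple a k = trans (+-distrib-/-∣ʳ a (n∣m*n k)) (cong (a / n +_) (m*n/n≡m k n))

  phase : ℕ → ℕ
  phase t = t * (p * l) / n

  phase-step : ∀ m t → phase (m * j + t) ≡ phase t + m * (c + p * r)
  phase-step m t = trans (cong (_/ n) (begin
    (m * j + t) * (p * l)          ≡⟨ expand m j t p l ⟩
    t * (p * l) + m * (p * j * l)  ≡⟨ cong (λ z → t * (p * l) + m * z) condition ⟩
    t * (p * l) + m * (n * (c + p * r)) ≡⟨ cong (t * (p * l) +_) (collect m n (c + p * r)) ⟩
    t * (p * l) + m * (c + p * r) * n ∎)) (/-add-multiple (t * (p * l)) (m * (c + p * r)))
    where
    open ≡-Reasoning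
    expand : ∀ m j t p l → (m * j + t) * (p * l) ≡ t * (p * l) + m * (p * j * l)
    expand = solve-∀
    collect : ∀ m n x → m * (n * x) ≡ m * x * n
    collect = solve-∀

  -- The a-values sample the pattern at the phase; the b-values solve the a-equations.
  H Y : ℕ → ℚ
  H t = φ (phase t % p)
  Y t = -q (H (t + j) +q H (t + (n ∸ j)))

  H-periodic : Per H n
  H-periodic t = cong φ (begin
    phase (n + t) % p           ≡⟨ cong (λ z → z / n % p) (expand n t (p * l)) ⟩
    (t * (p * l) + p * l * n) / n % p ≡⟨ cong (_% p) (/-add-multiple (t * (p * l)) (p * l)) ⟩
    (phase t + p * l) % p       ≡⟨ cong (λ z → (phase t + z) % p) (*-comm p l) ⟩
    (phase t + l * p) % p       ≡⟨ [m+kn]%n≡m%n (phase t) l p ⟩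
    phase t % p                 ∎)
    where
    open ≡-Reasoning
    expand : ∀ n t x → (n + t) * x ≡ t * x + x * n
    expand = solve-∀

  Y-periodic : Per Y n
  Y-periodic t = cong -q_
    (cong₂ _+q_ (per-translate {H} {n} H-periodic j t) (per-translate {H} {n} H-periodic (n ∸ j) t))

  H-orbit : ∀ m s → H (m * j + s) ≡ φ ((phase s % p + m * c) % p)
  H-orbit m s = cong φ (begin
    phase (m * j + s) % p                 ≡⟨ cong (_% p) (phase-step m s) ⟩
    (phase s + m * (c + p * r)) % p       ≡⟨ cong (_% p) (expand (phase s) m c p r) ⟩
    (phase s + m * c + m * r * p) % p     ≡⟨ [m+kn]%n≡m%n (phase s + m * c) (m * r) p ⟩
    (phase s + m * c) % p                 ≡⟨ sym (%-absorbˡ (phase s) (m * c) p) ⟩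
    (phase s % p + m * c) % p             ∎)
    where
    open ≡-Reasoning
    expand : ∀ e m c p r → e + m * (c + p * r) ≡ e + m * c + m * r * p
    expand = solve-∀

  b-lhs : ℕ → ℚ
  b-lhs t = H t +q (Y (t + 2 * j) +q Y (t + (n ∸ 2 * j)))

  b-lhs-periodic : Per b-lhs n
  b-lhs-periodic t = cong₂ _+q_ (H-periodic t) (cong₂ _+q_
    (per-translate {Y} {n} Y-periodic (2 * j) t) (per-translate {Y} {n} Y-periodic (n ∸ 2 * j) t))

  -- At t = 3j + s every neighbour index is s + m j up to a full period, so the
  -- equation becomes the pattern equation at the phase of s.
  b-lhs-orbit : ∀ s → b-lhs (3 * j + s) ≡ 0ℚ
  b-lhs-orbit s = begin
    b-lhs (3 * j + s)
      ≡⟨ cong₂ _+q_ (H-orbit 3 s)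
           (cong₂ _+q_ (cong -q_ (cong₂ _+q_ h₆ h₄)) (trans y₁ (cong -q_ (cong₂ _+q_ h₂ h₀)))) ⟩
    pattern-lhs p c φ (phase s % p)
      ≡⟨ subst (λ e → pattern-lhs p c φ e ≡ 0ℚ) (toℕ-fromℕ< (m%n<n (phase s) p))
               (pattern-eq (fromℕ< (m%n<n (phase s) p))) ⟩
    0ℚ ∎
    where
    open ≡-Reasoning
    Φ : ℕ → ℚ
    Φ m = φ ((phase s % p + m * c) % p)
    h₆ : H (3 * j + s + 2 * j + j) ≡ Φ 6
    h₆ = trans (cong H (step s j)) (H-orbit 6 s)
      where step : ∀ s j → 3 * j + s + 2 * j + j ≡ 6 * j + s
            step = solve-∀
    h₄ : H (3 * j + s + 2 * j + (n ∸ j)) ≡ Φ 4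
    h₄ = trans (cong (λ z → H (z + (n ∸ j))) (step s j))
               (trans (per-back {H} {n} H-periodic j j≤n (4 * j + s)) (H-orbit 4 s))
      where step : ∀ s j → 3 * j + s + 2 * j ≡ 4 * j + s + j
            step = solve-∀
    y₁ : Y (3 * j + s + (n ∸ 2 * j)) ≡ Y (1 * j + s)
    y₁ = trans (cong (λ z → Y (z + (n ∸ 2 * j))) (step s j))
               (per-back {Y} {n} Y-periodic (2 * j) 2j≤n (1 * j + s))
      where step : ∀ s j → 3 * j + s ≡ 1 * j + s + 2 * j
            step = solve-∀
    h₂ : H (1 * j + s + j) ≡ Φ 2
    h₂ = trans (cong H (step s j)) (H-orbit 2 s)
      where step : ∀ s j → 1 * j + s + j ≡ 2 * j + s
            step = solve-∀
    h₀ : H (1 * j + s + (n ∸ j)) ≡ Φ 0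
    h₀ = trans (cong (λ z → H (z + (n ∸ j))) (step s j))
               (trans (per-back {H} {n} H-periodic j j≤n s) (H-orbit 0 s))
      where step : ∀ s j → 1 * j + s ≡ s + j
            step = solve-∀

  -- The a-equations hold by the choice of Y; the b-equation reduces by periodicity
  -- to the orbit form above.
  kernel-eqs : KernelEqs n j (2 * j) H Y
  kernel-eqs = (λ t → ℚP.+-inverseʳ (H (t + j) +q H (t + (n ∸ j)))) , b-equation
    where
    b-equation : ∀ t → b-lhs t ≡ 0ℚ
    b-equation t =
      trans (sym (b-lhs-periodic t)) (trans (cong b-lhs (shift t)) (b-lhs-orbit (t + (n ∸ 3 * j))))
      where
      shift : ∀ t → n + t ≡ 3 * j + (t + (n ∸ 3 * j))
      shift t = trans (cong (_+ t) (sym (m∸n+n≡m 3j≤n))) (rotate (n ∸ 3 * j) (3 * j) t)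
        where rotate : ∀ d e t → d + e + t ≡ e + (t + d)
              rotate = solve-∀

  is-eigenvalue : IsEigenvalue n (adjMatI n j (2 * j)) 0ℚ
  is-eigenvalue = sample H Y , (inj₁ (fin 0) , nonzero) ,
                  Rows.eqs⇒kernel 0<j j+j<n 0<2j 2j+2j<n {sample H Y} represents kernel-eqs
    where
    represents : Represents (sample H Y) H Y
    represents = sample-represents H-periodic Y-periodic
    value-at-0 : sample H Y (inj₁ (fin 0)) ≡ 1ℚ
    value-at-0 = begin
      sample H Y (inj₁ (fin 0)) ≡⟨ proj₁ represents 0 ⟩
      φ (phase 0 % p)           ≡⟨ cong (λ z → φ (z % p)) (0/n≡0 n) ⟩
      φ (0 % p)                 ≡⟨ cong φ (m<n⇒m%n≡m (>-nonZero⁻¹ p)) ⟩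
      φ 0                       ≡⟨ φ0≡1 ⟩
      1ℚ                        ∎
      where open ≡-Reasoning
    nonzero : ¬ (sample H Y (inj₁ (fin 0)) ≡ 0ℚ)
    nonzero e with () ← trans (sym value-at-0) e

condition⇒eigenvalue : ∀ n j .{{_ : NonZero n}} → 0 < j → 4 * j < n →
  Condition n j → IsEigenvalue n (adjMatI n j (2 * j)) 0ℚ
condition⇒eigenvalue n j 0<j 4j<n (l , _ , r , inj₁ e) =
  Construction.is-eigenvalue n j 0<j 4j<n 3 1 r l φ₃ refl (from-yes (pattern? 3 1 φ₃)) e
condition⇒eigenvalue n j 0<j 4j<n (l , _ , r , inj₂ (inj₁ e)) =
  Construction.is-eigenvalue n j 0<j 4j<n 3 2 r l φ₃ refl (from-yes (pattern? 3 2 φ₃)) e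
condition⇒eigenvalue n j 0<j 4j<n (l , _ , r , inj₂ (inj₂ (inj₁ e))) =
  Construction.is-eigenvalue n j 0<j 4j<n 10 1 r l φ₁₀ refl (from-yes (pattern? 10 1 φ₁₀)) e
condition⇒eigenvalue n j 0<j 4j<n (l , _ , r , inj₂ (inj₂ (inj₂ (inj₁ e)))) =
  Construction.is-eigenvalue n j 0<j 4j<n 10 3 r l φ₁₀ refl (from-yes (pattern? 10 3 φ₁₀)) e
condition⇒eigenvalue n j 0<j 4j<n (l , _ , r , inj₂ (inj₂ (inj₂ (inj₂ (inj₁ e))))) =
  Construction.is-eigenvalue n j 0<j 4j<n 10 7 r l φ₁₀ refl (from-yes (pattern? 10 7 φ₁₀)) e
condition⇒eigenvalue n j 0<j 4j<n (l , _ , r , inj₂ (inj₂ (inj₂ (inj₂ (inj₂ e))))) =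
  Construction.is-eigenvalue n j 0<j 4j<n 10 9 r l φ₁₀ refl (from-yes (pattern? 10 9 φ₁₀)) e

lemma2 : (n j : ℕ) .{{_ : NonZero n}} → 3 ≤ n → 1 ≤ j → 4 * j < n →
    IsEigenvalue n (adjMatI n j (2 * j)) 0ℚ ⇔
      (Σ ℕ λ l → l < n × Σ ℕ λ r →
        (3 * j * l ≡ n * (1 + 3 * r)) ⊎ (3 * j * l ≡ n * (2 + 3 * r)) ⊎
        (10 * j * l ≡ n * (1 + 10 * r)) ⊎ (10 * j * l ≡ n * (3 + 10 * r)) ⊎
        (10 * j * l ≡ n * (7 + 10 * r)) ⊎ (10 * j * l ≡ n * (9 + 10 * r)))
lemma2 n j _ 0<j 4j<n =
  mk⇔ (EigenvalueToCondition.eigenvalue⇒condition n j 0<j 4j<n)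
      (condition⇒eigenvalue n j 0<j 4j<n)
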